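{- Let $R < 10/7$ be a real number, $\lambda$ a positive integer, and $\mathcal{F} = \{F^c_{t,k}\}$ an F-system such that $|F^A_t \cup F^B_t| \le R t + \lambda$ for every positive integer $t$. Then for every positive integer $t$, $|S_t| \ge (2-R)t - \lambda$.
   Context: An F-system is a family $\mathcal{F} = \{F^c_{t,k}\}$ of sets of positive integers, indexed by $c \in \{A,B\}$ and integers $t,k$ with $0 < k \le t$, such that (F1) $|F^c_{t,k}| \ge k$ for all $c,t,k$, and (F2) $F^A_{t,k} \cap F^B_{t',k'} = \emptyset$ for all $k,t,k',t'$ with $k + k' \le \max(t,t')$. For $c \in \{A,B\}$ and a positive integer $t$, $F^c_t = \bigcup_{\kappa \le \tau \le t} F^c_{\tau,\kappa}$ (union over integers $0<\kappa\le\tau\le t$), and $S_t = F^A_t \cap F^B_t$.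
   Formalization: The parameter R ranges over the rationals rather than the reals. -}

module Defs where

open import Data.Nat as ℕ using (ℕ; zero; suc; _≤_; _<_; _⊔_; _+_)
open import Data.Nat.Properties using (_≟_)
open import Data.List using (List; length; deduplicate; filter; concat; map; upTo; _++_)
open import Data.List.Relation.Unary.All using (All)
open import Data.List.Membership.Propositional using (_∈_)
open import Data.List.Membership.DecPropositional _≟_ using (_∈?_)
open import Data.Empty using (⊥)
open import Data.Integer using (+_)
open import Data.Rational using (ℚ; _/_)

-- Finite sets of natural numbers are represented by lists (duplicates allowed,
-- set semantics via membership).
FinSet : Set
FinSet = List ℕ

card : FinSet → ℕ
card xs = length (deduplicate _≟_ xs)

_∪_ : FinSet → FinSet → FinSet
xs ∪ ys = xs ++ ys

_∩_ : FinSet → FinSet → FinSet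
xs ∩ ys = filter (_∈? ys) xs

Disjoint : FinSet → FinSet → Set
Disjoint xs ys = ∀ x → x ∈ xs → x ∈ ys → ⊥

data Color : Set where
  A B : Color

-- An F-system: F c t k is F^c_{t,k}; only indices 0 < k ≤ t are meaningful.
record FSystem : Set where
  field
    F   : Color → ℕ → ℕ → FinSet
    pos : ∀ c t k → 0 < k → k ≤ t → All (λ x → 1 ≤ x) (F c t k)
    F1  : ∀ c t k → 0 < k → k ≤ t → k ≤ card (F c t k)
    F2  : ∀ t k t' k' → 0 < k → k ≤ t → 0 < k' → k' ≤ t' →
          k + k' ≤ t ⊔ t' → Disjoint (F A t k) (F B t' k')

open FSystem public

-- F^c_t = ⋃_{0 < κ ≤ τ ≤ t} F^c_{τ,κ}
Fc : FSystem → Color → ℕ → FinSet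
Fc 𝓕 c t = concat (map (λ i → concat (map (λ j → F 𝓕 c (suc i) (suc j)) (upTo (suc i)))) (upTo t))

S : FSystem → ℕ → FinSet
S 𝓕 t = Fc 𝓕 A t ∩ Fc 𝓕 B t

ℕ→ℚ : ℕ → ℚ
ℕ→ℚ n = + n / 1

-- F^A_t and F^B_t each contain F^c_{t,t}, so each has at least t elements by (F1).
-- Inclusion–exclusion then gives |S_t| ≥ 2t − |F^A_t ∪ F^B_t| ≥ (2 − R) t − λ.
module Submission where

open import Defs
open import Data.Nat as N using (ℕ; zero; suc; z≤n; s≤s)
import Data.Nat.Properties as NP
open import Data.Integer as ℤ using (+_)
import Data.Integer.Properties as ℤP
open import Data.Rational using (ℚ; mkℚ; _/_; _+_; _-_; _*_; -_; _≤_; _<_; *≤*)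
import Data.Rational.Properties as QP
open import Data.Rational.Solver using (module +-*-Solver)
import Data.Nat.Coprimality as Coprimality
open import Data.List using (List; []; _∷_; length; deduplicate; filter; concat; map; upTo; _++_)
open import Data.List.Properties using (filter-notAll; length-++)
open import Data.List.Relation.Unary.Any using (here; there)
import Data.List.Relation.Unary.Any as Any
import Data.List.Relation.Unary.All as All
open import Data.List.Relation.Unary.AllPairs using (_∷_)
open import Data.List.Relation.Unary.Unique.Propositional using (Unique)
import Data.List.Relation.Unary.Unique.Propositional.Properties as Unique
open import Data.List.Relation.Unary.Unique.DecPropositional.Properties N._≟_ using (deduplicate-!)
open import Data.List.Relation.Binary.Subset.Propositional using (_⊆_)
open import Data.List.Membership.Propositional.Properties
open import Data.List.Membership.DecPropositional N._≟_ using (_∈?_)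
open import Relation.Binary.Definitions using (DecidableEquality)
open import Relation.Binary.PropositionalEquality
open import Relation.Nullary using (¬?; yes; no)
open import Relation.Unary using (Decidable)
open import Function using (_∘_)
open import Data.Sum using (inj₁; inj₂)
open import Data.Product using (_,_; proj₁; proj₂)

module _ {A : Set} where

  Unique-⊆⇒length≤ : DecidableEquality A → {xs ys : List A} →
                      Unique xs → xs ⊆ ys → length xs N.≤ length ys
  Unique-⊆⇒length≤ _≟_ {[]} _ _ = z≤n
  Unique-⊆⇒length≤ _≟_ {x ∷ xs} {ys} (x∉xs ∷ !xs) xs⊆ys =
    NP.≤-trans (s≤s (Unique-⊆⇒length≤ _≟_ !xs xs⊆ys-x))
               (filter-notAll ≢x? ys (Any.map (λ { refl x≢x → x≢x refl }) (xs⊆ys (here refl))))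
    where
    ≢x? = λ y → ¬? (x ≟ y)
    xs⊆ys-x : xs ⊆ filter ≢x? ys
    xs⊆ys-x y∈xs = ∈-filter⁺ ≢x? (xs⊆ys (there y∈xs)) (All.lookup x∉xs y∈xs)

  length-filter-split : {P : A → Set} (P? : Decidable P) (xs : List A) →
                        length xs ≡ length (filter P? xs) N.+ length (filter (¬? ∘ P?) xs)
  length-filter-split P? []       = refl
  length-filter-split P? (x ∷ xs) with P? x
  ... | yes _ = cong suc (length-filter-split P? xs)
  ... | no  _ = trans (cong suc (length-filter-split P? xs)) (sym (NP.+-suc _ _))

card-mono : {xs ys : FinSet} → xs ⊆ ys → card xs N.≤ card ys
card-mono {xs} xs⊆ys = Unique-⊆⇒length≤ N._≟_ (deduplicate-! xs)
  (λ x∈ → ∈-deduplicate⁺ N._≟_ (xs⊆ys (∈-deduplicate⁻ N._≟_ xs x∈)))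

card-+≤card-∪-+card-∩ : (xs ys : FinSet) →
                         card xs N.+ card ys N.≤ card (xs ∪ ys) N.+ card (xs ∩ ys)
card-+≤card-∪-+card-∩ xs ys = begin
  length xs′ N.+ length ys′
    ≡⟨ cong (length xs′ N.+_) (length-filter-split (_∈? xs) ys′) ⟩
  length xs′ N.+ (length ys′∩xs N.+ length ys′∖xs)
    ≡⟨ NP.+-comm (length xs′) _ ⟩
  (length ys′∩xs N.+ length ys′∖xs) N.+ length xs′
    ≡⟨ NP.+-assoc (length ys′∩xs) _ _ ⟩
  length ys′∩xs N.+ (length ys′∖xs N.+ length xs′)
    ≡⟨ cong (length ys′∩xs N.+_) (trans (NP.+-comm _ (length xs′)) (sym (length-++ xs′))) ⟩
  length ys′∩xs N.+ length (xs′ ++ ys′∖xs)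
    ≤⟨ NP.+-mono-≤ ys′∩xs≤ xs′++ys′∖xs≤ ⟩
  card (xs ∩ ys) N.+ card (xs ∪ ys)
    ≡⟨ NP.+-comm (card (xs ∩ ys)) _ ⟩
  card (xs ∪ ys) N.+ card (xs ∩ ys) ∎
  where
  open NP.≤-Reasoning
  xs′ = deduplicate N._≟_ xs
  ys′ = deduplicate N._≟_ ys
  ∉xs? = λ y → ¬? (y ∈? xs)
  ys′∩xs = filter (_∈? xs) ys′
  ys′∖xs = filter ∉xs? ys′

  ys′∩xs≤ : length ys′∩xs N.≤ card (xs ∩ ys)
  ys′∩xs≤ = Unique-⊆⇒length≤ N._≟_ (Unique.filter⁺ (_∈? xs) (deduplicate-! ys)) λ y∈ →
    let (y∈ys′ , y∈xs) = ∈-filter⁻ (_∈? xs) y∈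
    in ∈-deduplicate⁺ N._≟_ (∈-filter⁺ (_∈? ys) y∈xs (∈-deduplicate⁻ N._≟_ ys y∈ys′))

  xs′++ys′∖xs≤ : length (xs′ ++ ys′∖xs) N.≤ card (xs ∪ ys)
  xs′++ys′∖xs≤ = Unique-⊆⇒length≤ N._≟_ unique (λ y∈ → ∈-deduplicate⁺ N._≟_ (⊆xs++ys y∈))
    where
    unique : Unique (xs′ ++ ys′∖xs)
    unique = Unique.++⁺ (deduplicate-! xs) (Unique.filter⁺ ∉xs? (deduplicate-! ys))
      λ (y∈xs′ , y∈ys′∖xs) → proj₂ (∈-filter⁻ ∉xs? {xs = ys′} y∈ys′∖xs) (∈-deduplicate⁻ N._≟_ xs y∈xs′)
    ⊆xs++ys : xs′ ++ ys′∖xs ⊆ xs ++ ys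
    ⊆xs++ys y∈ with ∈-++⁻ xs′ y∈
    ... | inj₁ y∈xs′   = ∈-++⁺ˡ (∈-deduplicate⁻ N._≟_ xs y∈xs′)
    ... | inj₂ y∈ys′∖xs = ∈-++⁺ʳ xs (∈-deduplicate⁻ N._≟_ ys (proj₁ (∈-filter⁻ ∉xs? {xs = ys′} y∈ys′∖xs)))

F-diagonal⊆Fc : ∀ 𝓕 c n → F 𝓕 c (suc n) (suc n) ⊆ Fc 𝓕 c (suc n)
F-diagonal⊆Fc 𝓕 c n x∈ =
  ∈-concat⁺′ (∈-concat⁺′ x∈ (∈-map⁺ (λ j → F 𝓕 c (suc n) (suc j)) (∈-upTo⁺ NP.≤-refl)))
             (∈-map⁺ (λ i → concat (map (λ j → F 𝓕 c (suc i) (suc j)) (upTo (suc i))))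
                     (∈-upTo⁺ NP.≤-refl))

t≤card-Fc : ∀ 𝓕 c t → t N.≤ card (Fc 𝓕 c t)
t≤card-Fc 𝓕 c zero    = z≤n
t≤card-Fc 𝓕 c (suc n) =
  NP.≤-trans (F1 𝓕 c (suc n) (suc n) (s≤s z≤n) NP.≤-refl) (card-mono (F-diagonal⊆Fc 𝓕 c n))

2t≤card-∪-+card-S : ∀ 𝓕 t → t N.+ t N.≤ card (Fc 𝓕 A t ∪ Fc 𝓕 B t) N.+ card (S 𝓕 t)
2t≤card-∪-+card-S 𝓕 t = NP.≤-trans (NP.+-mono-≤ (t≤card-Fc 𝓕 A t) (t≤card-Fc 𝓕 B t))
                                   (card-+≤card-∪-+card-∩ (Fc 𝓕 A t) (Fc 𝓕 B t))

-- + n / 1 is stuck on the gcd normalisation for a variable n; its normal form mkℚ is not.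
ℕ→ℚ≡mkℚ : ∀ n → ℕ→ℚ n ≡ mkℚ (+ n) 0 (Coprimality.sym (Coprimality.1-coprimeTo n))
ℕ→ℚ≡mkℚ n = QP.↥p/↧p≡p (mkℚ (+ n) 0 (Coprimality.sym (Coprimality.1-coprimeTo n)))

ℕ→ℚ-+ : ∀ m n → ℕ→ℚ (m N.+ n) ≡ ℕ→ℚ m + ℕ→ℚ n
ℕ→ℚ-+ m n rewrite ℕ→ℚ≡mkℚ m | ℕ→ℚ≡mkℚ n =
  QP./-cong (cong₂ ℤ._+_ (sym (ℤP.*-identityʳ (+ m))) (sym (ℤP.*-identityʳ (+ n)))) refl

ℕ→ℚ-mono-≤ : ∀ {m n} → m N.≤ n → ℕ→ℚ m ≤ ℕ→ℚ n
ℕ→ℚ-mono-≤ {m} {n} m≤n rewrite ℕ→ℚ≡mkℚ m | ℕ→ℚ≡mkℚ n =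
  *≤* (subst₂ ℤ._≤_ (sym (ℤP.*-identityʳ (+ m))) (sym (ℤP.*-identityʳ (+ n))) (ℤ.+≤+ m≤n))

t+t≤u+s∧u≤Rt+l⇒[2-R]t-l≤s : ∀ (R t l s u : ℚ) →
                             t + t ≤ u + s → u ≤ R * t + l → (ℕ→ℚ 2 - R) * t - l ≤ s
t+t≤u+s∧u≤Rt+l⇒[2-R]t-l≤s R t l s u t+t≤u+s u≤Rt+l =
  subst₂ _≤_ lhs rhs (QP.+-monoˡ-≤ (- (R * t) - l) t+t≤Rt+l+s)
  where
  open +-*-Solver
  t+t≤Rt+l+s : t + t ≤ R * t + l + s
  t+t≤Rt+l+s = QP.≤-trans t+t≤u+s (QP.+-monoˡ-≤ s u≤Rt+l)
  lhs : t + t + (- (R * t) - l) ≡ (ℕ→ℚ 2 - R) * t - l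
  lhs = solve 3 (λ R t l → t :+ t :+ (:- (R :* t) :- l) := (con (ℕ→ℚ 2) :- R) :* t :- l) refl R t l
  rhs : R * t + l + s + (- (R * t) - l) ≡ s
  rhs = solve 4 (λ R t l s → R :* t :+ l :+ s :+ (:- (R :* t) :- l) := s) refl R t l s

lemma2 : (R : ℚ) → R < + 10 / 7 → (λ' : ℕ) → 1 N.≤ λ' → (𝓕 : FSystem) →
    (∀ t → 1 N.≤ t → ℕ→ℚ (card (Fc 𝓕 A t ∪ Fc 𝓕 B t)) ≤ R * ℕ→ℚ t + ℕ→ℚ λ') →
    ∀ t → 1 N.≤ t → (ℕ→ℚ 2 - R) * ℕ→ℚ t - ℕ→ℚ λ' ≤ ℕ→ℚ (card (S 𝓕 t))
lemma2 R _ λ' _ 𝓕 union-bound t 1≤t =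
  t+t≤u+s∧u≤Rt+l⇒[2-R]t-l≤s R (ℕ→ℚ t) (ℕ→ℚ λ') (ℕ→ℚ (card (S 𝓕 t))) (ℕ→ℚ ∣F^A∪F^B∣)
    (subst₂ _≤_ (ℕ→ℚ-+ t t) (ℕ→ℚ-+ ∣F^A∪F^B∣ (card (S 𝓕 t))) (ℕ→ℚ-mono-≤ (2t≤card-∪-+card-S 𝓕 t)))
    (union-bound t 1≤t)
  where
  ∣F^A∪F^B∣ = card (Fc 𝓕 A t ∪ Fc 𝓕 B t)
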